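{- Let $G$ be a $C_5^-$-free $3$-graph on $n\ge 4$ vertices. Then $p(K_4^-,G)+p(K_4,G)\le \frac{4}{n-3}$.
   Context: A $3$-graph is a $3$-uniform hypergraph. $C_5^-$ is the $3$-graph on vertex set $\{1,\dots,5\}$ with edges $123,234,345,451$. $K_4$ is the complete $3$-graph on $4$ vertices and $K_4^-$ is $K_4$ with one edge removed (4 vertices, 3 edges). For $3$-graphs $H$ on $k$ vertices and $G$ on $n>k$ vertices, $p(H,G)=|\{X\subseteq V(G): G[X]\cong H\}|/\binom nk$ is the induced density of $H$ in $G$. -}

module Defs where

open import Data.Bool using (Bool; true; false; _∧_; _∨_; not; if_then_else_)
open import Data.Nat using (ℕ; zero; suc; _≤_; _<_; _∸_; _≡ᵇ_; z≤n; s≤s; NonZero; >-nonZero)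
open import Data.Nat.Properties using (≤-trans; m≤m+n)
open import Data.Nat.Combinatorics using (_C_; nCk≡nC[n∸k]; nCn≡1; nCk+nC[k+1]≡[n+1]C[k+1])
open import Data.Fin using (Fin; _≟_)
open import Data.Fin.Subset using (Subset; ∣_∣; ⁅_⁆; _∪_)
open import Data.Vec using (Vec; []; _∷_; lookup)
open import Data.List using (List; []; _∷_; map; concatMap; _++_; allFin)
open import Data.Bool.ListAction using (all; any)
open import Data.Nat.ListAction using (sum)
open import Data.Integer using (+_)
open import Data.Rational using (ℚ; _/_)
open import Relation.Nullary using (¬_; ⌊_⌋)
open import Relation.Binary.PropositionalEquality using (_≡_; refl; subst; sym)
open import Data.Product using (Σ; _×_)
open import Function.Definitions using (Injective)
import Data.Bool.Properties as BoolP
import Data.Vec.Properties as VecP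
import Data.Nat.Properties as NatP
open import Data.Bool using (T)
open import Data.Unit using (tt)

record ThreeGraph (n : ℕ) : Set where
  field
    edge    : Subset n → Bool
    uniform : ∀ S → edge S ≡ true → ∣ S ∣ ≡ 3
open ThreeGraph public

-- the 3-set {a, b, c} (of size < 3 if the entries are not distinct)
triple : ∀ {n} → Fin n → Fin n → Fin n → Subset n
triple a b c = ⁅ a ⁆ ∪ (⁅ b ⁆ ∪ ⁅ c ⁆)

mk3graph : ∀ {n} → (Subset n → Bool) → ThreeGraph n
mk3graph P = record { edge = λ S → (∣ S ∣ ≡ᵇ 3) ∧ P S ; uniform = u }
  where
  u : ∀ S → ((∣ S ∣ ≡ᵇ 3) ∧ P S) ≡ true → ∣ S ∣ ≡ 3
  u S eq with ∣ S ∣ ≡ᵇ 3 in e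
  u S eq    | true = NatP.≡ᵇ⇒≡ ∣ S ∣ 3 (subst T (sym e) tt)
  u S ()    | false

-- The specific 3-graphs (vertices 1..k of the paper are Fin k = 0..k-1).

K4 : ThreeGraph 4
K4 = mk3graph (λ _ → true)

-- K4⁻: K4 minus the edge {0,1,2}; i.e. the 3-sets containing vertex 3.
K4⁻ : ThreeGraph 4
K4⁻ = mk3graph (λ S → lookup S (Data.Fin.fromℕ 3))
  where import Data.Fin

-- C5⁻ with edges 123, 234, 345, 451 (paper labels), i.e.
-- {0,1,2}, {1,2,3}, {2,3,4}, {3,4,0}.
C5⁻edges : List (Subset 5)
C5⁻edges =
  (true  ∷ true  ∷ true  ∷ false ∷ false ∷ []) ∷
  (false ∷ true  ∷ true  ∷ true  ∷ false ∷ []) ∷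
  (false ∷ false ∷ true  ∷ true  ∷ true  ∷ []) ∷
  (true  ∷ false ∷ false ∷ true  ∷ true  ∷ []) ∷ []

C5⁻ : ThreeGraph 5
C5⁻ = mk3graph (λ S → any (λ T → ⌊ VecP.≡-dec BoolP._≟_ S T ⌋) C5⁻edges)

Contains : ∀ {k n} → ThreeGraph n → ThreeGraph k → Set
Contains {k} {n} G F =
  Σ (Fin k → Fin n) λ f →
    Injective _≡_ _≡_ f ×
    (∀ i j l → edge F (triple i j l) ≡ true →
               edge G (triple (f i) (f j) (f l)) ≡ true)

Free : ∀ {k n} → ThreeGraph k → ThreeGraph n → Set
Free F G = ¬ Contains G F

allSubsets : ∀ n → List (Subset n)
allSubsets zero    = [] ∷ []
allSubsets (suc n) = map (true ∷_) (allSubsets n) ++ map (false ∷_) (allSubsets n)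

allMaps : ∀ k n → List (Vec (Fin n) k)
allMaps zero    n = [] ∷ []
allMaps (suc k) n = concatMap (λ v → map (_∷ v) (allFin n)) (allMaps k n)

-- G[X] ≅ H (decided by brute force): there is a map f : Fin k → Fin n which
-- is injective, lands in X (hence, when |X| = k, is a bijection onto X),
-- and such that {i,j,l} is an edge of H iff {f i, f j, f l} is an edge of G.
inducedIso? : ∀ {k n} → ThreeGraph k → ThreeGraph n → Subset n → Bool
inducedIso? {k} {n} H G X = any good (allMaps k n)
  where
  good : Vec (Fin n) k → Bool
  good v =
    all (λ i → lookup X (lookup v i)) (allFin k) ∧
    all (λ i → all (λ j → ⌊ i ≟ j ⌋ ∨ not ⌊ lookup v i ≟ lookup v j ⌋) (allFin k)) (allFin k) ∧
    all (λ i → all (λ j → all (λ l →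
         ⌊ edge H (triple i j l) BoolP.≟ edge G (triple (lookup v i) (lookup v j) (lookup v l)) ⌋)
         (allFin k)) (allFin k)) (allFin k)

inducedCount : ∀ {k n} → ThreeGraph k → ThreeGraph n → ℕ
inducedCount {k} {n} H G =
  sum (map (λ X → if (∣ X ∣ ≡ᵇ k) ∧ inducedIso? H G X then 1 else 0) (allSubsets n))

nCk>0 : ∀ {n k} → k ≤ n → 0 < n C k
nCk>0 {n} {zero} _ = subst (0 <_) (sym (Relation.Binary.PropositionalEquality.trans (nCk≡nC[n∸k] {0} {n} z≤n) (nCn≡1 n))) (s≤s z≤n)
  where import Relation.Binary.PropositionalEquality
nCk>0 {suc n} {suc k} (s≤s k≤n) =
  subst (0 <_) (nCk+nC[k+1]≡[n+1]C[k+1] n k) (≤-trans (nCk>0 k≤n) (m≤m+n _ _))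

p : ∀ {k n} → ThreeGraph k → ThreeGraph n → k ≤ n → ℚ
p {k} {n} H G k≤n = (+ inducedCount H G / (n C k)) {{>-nonZero (nCk>0 k≤n)}}

n∸3-nonZero : ∀ {n} → 4 ≤ n → NonZero (n ∸ 3)
n∸3-nonZero (s≤s (s≤s (s≤s (s≤s _)))) = _

{-# OPTIONS --safe #-}
-- Call a 4-set X of vertices good if G[X] is a K4⁻ or a K4. A good X has an
-- apex: a vertex x ∈ X such that every triple of X through x is an edge.
-- Deleting an apex sends good 4-sets to 3-sets, injectively when G is
-- C5⁻-free: if X - x = Y - y = {a, b, c} with x ≠ y, then xab, xbc, ybc and
-- yca are edges, so a x b c y spans a C5⁻. Hence there are at most
-- (n C 3) = 4 (n C 4) / (n - 3) good 4-sets.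
module Submission where

open import Defs

module Counting where

  open import Data.Bool using (Bool; true; false; T; _∨_; if_then_else_)
  open import Data.Bool.Properties using (T-≡; T?)
  open import Data.Empty using (⊥-elim)
  open import Data.List using (List; []; _∷_; _++_; map; length; filterᵇ)
  open import Data.List.Membership.Propositional using (_∈_)
  open import Data.List.Membership.Propositional.Properties
    using (∈-∃++; ∈-++⁻; ∈-++⁺ˡ; ∈-++⁺ʳ; ∈-filter⁺; ∈-filter⁻)
  open import Data.List.Properties using (map-++; map-∘; length-++)
  open import Data.List.Relation.Unary.All as All using ()
  open import Data.List.Relation.Unary.Any using (here; there)
  open import Data.List.Relation.Unary.Unique.Propositional using (Unique; _∷_)
  import Data.List.Relation.Unary.Unique.Propositional.Properties as Unique
  open import Data.Nat using (ℕ; suc; _+_; _≤_; z≤n; s≤s)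
  open import Data.Nat.ListAction using (sum)
  open import Data.Nat.ListAction.Properties using (sum-++)
  open import Data.Nat.Properties using (+-suc; ≤-reflexive; ≤-trans)
  open import Data.Product using (_,_; proj₂)
  open import Data.Sum using (inj₁; inj₂)
  open import Function using (_∘_; Equivalence)
  open import Relation.Binary.PropositionalEquality
  open import Relation.Nullary using (¬_; contradiction)

  private variable
    A B : Set

  countᵇ : (A → Bool) → List A → ℕ
  countᵇ p xs = sum (map (λ x → if p x then 1 else 0) xs)

  countᵇ-++ : ∀ (p : A → Bool) xs ys → countᵇ p (xs ++ ys) ≡ countᵇ p xs + countᵇ p ys
  countᵇ-++ p xs ys = trans (cong sum (map-++ _ xs ys)) (sum-++ (map _ xs) _)

  countᵇ-map : ∀ (p : B → Bool) (f : A → B) xs → countᵇ p (map f xs) ≡ countᵇ (p ∘ f) xs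
  countᵇ-map p f xs = cong sum (sym (map-∘ xs))

  countᵇ-false : ∀ (xs : List A) → countᵇ (λ _ → false) xs ≡ 0
  countᵇ-false []       = refl
  countᵇ-false (_ ∷ xs) = countᵇ-false xs

  countᵇ≡length-filterᵇ : ∀ (p : A → Bool) xs → countᵇ p xs ≡ length (filterᵇ p xs)
  countᵇ≡length-filterᵇ p []       = refl
  countᵇ≡length-filterᵇ p (x ∷ xs) with p x
  ... | true  = cong suc (countᵇ≡length-filterᵇ p xs)
  ... | false = countᵇ≡length-filterᵇ p xs

  countᵇ-∨ : ∀ (p q : A → Bool) xs → (∀ x → T (p x) → ¬ T (q x)) →
             countᵇ p xs + countᵇ q xs ≡ countᵇ (λ x → p x ∨ q x) xs
  countᵇ-∨ p q []       disjoint = refl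
  countᵇ-∨ p q (x ∷ xs) disjoint with p x in px | q x in qx
  ... | true  | true  = ⊥-elim (disjoint x (Equivalence.from T-≡ px) (Equivalence.from T-≡ qx))
  ... | true  | false = cong suc (countᵇ-∨ p q xs disjoint)
  ... | false | true  = trans (+-suc (countᵇ p xs) (countᵇ q xs)) (cong suc (countᵇ-∨ p q xs disjoint))
  ... | false | false = countᵇ-∨ p q xs disjoint

  Unique⇒length≤ : ∀ {xs : List A} {ys : List B} → Unique xs →
    (f : ∀ {x} → x ∈ xs → B) →
    (∀ {x y} (x∈ : x ∈ xs) (y∈ : y ∈ xs) → f x∈ ≡ f y∈ → x ≡ y) →
    (∀ {x} (x∈ : x ∈ xs) → f x∈ ∈ ys) →
    length xs ≤ length ys
  Unique⇒length≤ {xs = []}     _                  _ _     _  = z≤n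
  Unique⇒length≤ {xs = x ∷ xs} (x∉xs ∷ xs-unique) f f-inj f∈ with ∈-∃++ (f∈ (here refl))
  ... | us , vs , refl =
    ≤-trans (s≤s (Unique⇒length≤ xs-unique (f ∘ there) f∘there-inj f∘there∈))
            (≤-reflexive (sym length-us++vs))
    where
    f∘there-inj : ∀ {y z} (y∈ : y ∈ xs) (z∈ : z ∈ xs) → f (there y∈) ≡ f (there z∈) → y ≡ z
    f∘there-inj y∈ z∈ = f-inj (there y∈) (there z∈)
    length-us++vs : length (us ++ f (here refl) ∷ vs) ≡ suc (length (us ++ vs))
    length-us++vs = trans (length-++ us) (trans (+-suc _ _) (cong suc (sym (length-++ us))))
    f∘there∈ : ∀ {y} (y∈ : y ∈ xs) → f (there y∈) ∈ us ++ vs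
    f∘there∈ y∈ with ∈-++⁻ us (f∈ (there y∈))
    ... | inj₁ ∈us         = ∈-++⁺ˡ ∈us
    ... | inj₂ (here eq)   = contradiction (sym (f-inj (there y∈) (here refl) eq)) (All.lookup x∉xs y∈)
    ... | inj₂ (there ∈vs) = ∈-++⁺ʳ us ∈vs

  countᵇ-≤-injection : ∀ {p q : A → Bool} {xs : List A} → Unique xs → (∀ x → x ∈ xs) →
    (φ : ∀ x → T (p x) → A) →
    (∀ x px → T (q (φ x px))) →
    (∀ x y px py → φ x px ≡ φ y py → x ≡ y) →
    countᵇ p xs ≤ countᵇ q xs
  countᵇ-≤-injection {A = A} {p} {q} {xs} xs-unique xs-complete φ φ-q φ-inj =
    subst₂ _≤_ (sym (countᵇ≡length-filterᵇ p xs)) (sym (countᵇ≡length-filterᵇ q xs))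
      (Unique⇒length≤ (Unique.filter⁺ {P = T ∘ p} (T? ∘ p) xs-unique) f
        (λ x∈ y∈ → φ-inj _ _ (p-holds x∈) (p-holds y∈))
        (λ x∈ → ∈-filter⁺ {P = T ∘ q} (T? ∘ q) (xs-complete _) (φ-q _ _)))
    where
    p-holds : ∀ {x} → x ∈ filterᵇ p xs → T (p x)
    p-holds = proj₂ ∘ ∈-filter⁻ {P = T ∘ p} (T? ∘ p) {xs = xs}
    f : ∀ {x} → x ∈ filterᵇ p xs → A
    f {x} x∈ = φ x (p-holds x∈)

module Subsets where

  open Counting
  open import Data.Bool using (Bool)
  open import Data.Fin using (Fin; zero; suc; _≟_)
  open import Data.Fin.Properties as Fin using (any?)
  open import Data.Fin.Subset using (Subset; ∣_∣; _∈_; _∉_; _⊆_; _-_; ⁅_⁆; Nonempty; inside; outside)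
  open import Data.Fin.Subset.Properties
    using ( p─⊥≡p; p─q⊆p; x∈p⇒∣p-x∣<∣p∣; x∈p∧x≢y⇒x∈p-y
          ; nonempty?; Empty-unique; ∣⊥∣≡0; ⊆-antisym)
  open import Data.List using (List; _++_; map)
  import Data.List.Membership.Propositional as List
  open import Data.List.Membership.Propositional.Properties using (∈-++⁺ˡ; ∈-++⁺ʳ; ∈-map⁺; ∈-map⁻)
  open import Data.List.Relation.Unary.All using ([])
  open import Data.List.Relation.Unary.Any using (here)
  open import Data.List.Relation.Unary.Unique.Propositional using (Unique; []; _∷_)
  import Data.List.Relation.Unary.Unique.Propositional.Properties as Unique
  open import Data.Nat using (ℕ; zero; suc; _+_; _≤_; _≡ᵇ_; z≤n)
  open import Data.Nat.Combinatorics using (_C_; nCk+nC[k+1]≡[n+1]C[k+1])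
  open import Data.Nat.Properties using (suc-injective; ≤-<-trans; n≮n)
  open import Data.Product using (∃; Σ; _×_; _,_)
  open import Data.Vec using ([]; _∷_; here; there)
  open import Data.Vec.Functional as Vector using ()
  open import Function using (_∘_)
  open import Function.Definitions using (Injective)
  open import Relation.Binary.PropositionalEquality
  open import Relation.Nullary using (¬_; yes; no; contradiction)

  private variable
    k n : ℕ

  allSubsets-complete : ∀ (p : Subset n) → p List.∈ allSubsets n
  allSubsets-complete []            = here refl
  allSubsets-complete (inside  ∷ p) = ∈-++⁺ˡ (∈-map⁺ (inside ∷_) (allSubsets-complete p))
  allSubsets-complete (outside ∷ p) = ∈-++⁺ʳ _ (∈-map⁺ (outside ∷_) (allSubsets-complete p))

  allSubsets-unique : ∀ n → Unique (allSubsets n)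
  allSubsets-unique zero    = [] ∷ []
  allSubsets-unique (suc n) = Unique.++⁺ (Unique.map⁺ ∷-injective (allSubsets-unique n))
                                         (Unique.map⁺ ∷-injective (allSubsets-unique n)) disjoint
    where
    ∷-injective : ∀ {b} {p q : Subset n} → _≡_ {A = Subset (suc n)} (b ∷ p) (b ∷ q) → p ≡ q
    ∷-injective refl = refl
    disjoint : ∀ {p} → ¬ (p List.∈ map (inside ∷_) (allSubsets n) × p List.∈ map (outside ∷_) (allSubsets n))
    disjoint (p∈ , q∈) with ∈-map⁻ (inside ∷_) p∈ | ∈-map⁻ (outside ∷_) q∈
    ... | _ , _ , refl | _ , _ , ()

  countᵇ-size≡C : ∀ n k → countᵇ (λ p → ∣ p ∣ ≡ᵇ k) (allSubsets n) ≡ n C k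
  countᵇ-size≡C zero    zero    = refl
  countᵇ-size≡C zero    (suc k) = refl
  countᵇ-size≡C (suc n) k = begin
    countᵇ size≡k (map (inside ∷_) ps ++ map (outside ∷_) ps)
      ≡⟨ countᵇ-++ size≡k (map (inside ∷_) ps) _ ⟩
    countᵇ size≡k (map (inside ∷_) ps) + countᵇ size≡k (map (outside ∷_) ps)
      ≡⟨ cong₂ _+_ (countᵇ-map size≡k (inside ∷_) ps) (countᵇ-map size≡k (outside ∷_) ps) ⟩
    countᵇ (λ p → suc ∣ p ∣ ≡ᵇ k) ps + countᵇ size≡k ps
      ≡⟨ pascal k ⟩
    suc n C k ∎
    where
    open ≡-Reasoning
    ps : List (Subset n)
    ps = allSubsets n
    size≡k : ∀ {m} → Subset m → Bool
    size≡k p = ∣ p ∣ ≡ᵇ k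
    pascal : ∀ k → countᵇ (λ p → suc ∣ p ∣ ≡ᵇ k) ps + countᵇ (λ p → ∣ p ∣ ≡ᵇ k) ps
                   ≡ suc n C k
    pascal zero    = cong₂ _+_ (countᵇ-false ps) (countᵇ-size≡C n 0)
    pascal (suc k) = trans (cong₂ _+_ (countᵇ-size≡C n k) (countᵇ-size≡C n (suc k)))
                           (nCk+nC[k+1]≡[n+1]C[k+1] n k)

  x∈p⇒suc∣p-x∣≡∣p∣ : ∀ {x} {p : Subset n} → x ∈ p → suc ∣ p - x ∣ ≡ ∣ p ∣
  x∈p⇒suc∣p-x∣≡∣p∣ {p = inside  ∷ p} here        = cong (suc ∘ ∣_∣) (p─⊥≡p p)
  x∈p⇒suc∣p-x∣≡∣p∣ {p = inside  ∷ p} (there x∈p) = cong suc (x∈p⇒suc∣p-x∣≡∣p∣ x∈p)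
  x∈p⇒suc∣p-x∣≡∣p∣ {p = outside ∷ p} (there x∈p) = x∈p⇒suc∣p-x∣≡∣p∣ x∈p

  x∉p-x : ∀ {x} {p : Subset n} → x ∉ p - x
  x∉p-x {x = suc x} {_ ∷ p} (there x∈p-x) = x∉p-x x∈p-x

  x∈p-y⇒x∈p : ∀ {x y} {p : Subset n} → x ∈ p - y → x ∈ p
  x∈p-y⇒x∈p {y = y} {p} = p─q⊆p p ⁅ y ⁆

  x∈p-y⇒x≢y : ∀ {x y} {p : Subset n} → x ∈ p - y → x ≢ y
  x∈p-y⇒x≢y x∈p-y refl = x∉p-x x∈p-y

  p-x⊆q-x⇒p⊆q : ∀ {x} {p q : Subset n} → x ∈ q → p - x ⊆ q - x → p ⊆ q
  p-x⊆q-x⇒p⊆q {x = x} x∈q p-x⊆q-x {z} z∈p with z ≟ x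
  ... | yes refl = x∈q
  ... | no z≢x   = x∈p-y⇒x∈p (p-x⊆q-x (x∈p∧x≢y⇒x∈p-y z∈p z≢x))

  p-x≡q-x⇒p≡q : ∀ {x} {p q : Subset n} → x ∈ p → x ∈ q → p - x ≡ q - x → p ≡ q
  p-x≡q-x⇒p≡q x∈p x∈q eq =
    ⊆-antisym (p-x⊆q-x⇒p⊆q x∈q (subst (_ ∈_) eq)) (p-x⊆q-x⇒p⊆q x∈p (subst (_ ∈_) (sym eq)))

  ∣p∣≡1+k⇒Nonempty : ∀ {p : Subset n} → ∣ p ∣ ≡ suc k → Nonempty p
  ∣p∣≡1+k⇒Nonempty {n = n} {p = p} ∣p∣≡1+k with nonempty? p
  ... | yes p-nonempty = p-nonempty
  ... | no  p-empty with () ← trans (sym ∣p∣≡1+k) (trans (cong ∣_∣ (Empty-unique p-empty)) (∣⊥∣≡0 n))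

  injective-∷ : ∀ {x} {f : Fin k → Fin n} → Injective _≡_ _≡_ f → (∀ i → f i ≢ x) →
                Injective _≡_ _≡_ (x Vector.∷ f)
  injective-∷ f-inj f≢x {zero}  {zero}  _  = refl
  injective-∷ f-inj f≢x {zero}  {suc j} eq = contradiction (sym eq) (f≢x j)
  injective-∷ f-inj f≢x {suc i} {zero}  eq = contradiction eq (f≢x i)
  injective-∷ f-inj f≢x {suc i} {suc j} eq = cong suc (f-inj eq)

  enumerate : ∀ {p : Subset n} → ∣ p ∣ ≡ k →
              Σ (Fin k → Fin n) λ f → Injective _≡_ _≡_ f × (∀ i → f i ∈ p)
  enumerate {k = zero}  _ = (λ ()) , (λ { {()} }) , λ ()
  enumerate {k = suc k} {p} ∣p∣≡1+k with ∣p∣≡1+k⇒Nonempty ∣p∣≡1+k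
  ... | x , x∈p with enumerate {p = p - x} (suc-injective (trans (x∈p⇒suc∣p-x∣≡∣p∣ x∈p) ∣p∣≡1+k))
  ... | f , f-inj , f∈p-x =
    x Vector.∷ f , injective-∷ f-inj (x∈p-y⇒x≢y ∘ f∈p-x) , x∷f∈p
    where
    x∷f∈p : ∀ i → (x Vector.∷ f) i ∈ p
    x∷f∈p zero    = x∈p
    x∷f∈p (suc i) = x∈p-y⇒x∈p (f∈p-x i)

  injection⇒≤∣p∣ : ∀ {p : Subset n} (f : Fin k → Fin n) → Injective _≡_ _≡_ f → (∀ i → f i ∈ p) →
                   k ≤ ∣ p ∣
  injection⇒≤∣p∣ {k = zero}  f _ _ = z≤n
  injection⇒≤∣p∣ {k = suc k} {p = p} f f-inj f∈p =
    ≤-<-trans (injection⇒≤∣p∣ (f ∘ suc) (Fin.suc-injective ∘ f-inj) f∘suc∈p-f0)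
              (x∈p⇒∣p-x∣<∣p∣ (f∈p zero))
    where
    f∘suc∈p-f0 : ∀ i → f (suc i) ∈ p - f zero
    f∘suc∈p-f0 i = x∈p∧x≢y⇒x∈p-y (f∈p (suc i)) (Fin.0≢1+n ∘ sym ∘ f-inj)

  injection⇒surjective : ∀ {p : Subset n} (f : Fin k → Fin n) → Injective _≡_ _≡_ f → (∀ i → f i ∈ p) →
                         ∣ p ∣ ≡ k → ∀ {x} → x ∈ p → ∃ λ i → f i ≡ x
  injection⇒surjective {k = k} {p = p} f f-inj f∈p ∣p∣≡k {x} x∈p with any? (λ i → f i ≟ x)
  ... | yes hit = hit
  ... | no miss =
    contradiction (subst (suc k ≤_) ∣p∣≡k (injection⇒≤∣p∣ (x Vector.∷ f) x∷f-inj x∷f∈p)) (n≮n k)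
    where
    x∷f-inj : Injective _≡_ _≡_ (x Vector.∷ f)
    x∷f-inj = injective-∷ f-inj (λ i eq → miss (i , eq))
    x∷f∈p : ∀ i → (x Vector.∷ f) i ∈ p
    x∷f∈p zero    = x∈p
    x∷f∈p (suc i) = f∈p i

module Binomial where

  open import Data.Nat using (ℕ; zero; suc; _+_; _*_; _∸_; _≤_)
  open import Data.Nat.Combinatorics using (_C_; nC1≡n; nCk+nC[k+1]≡[n+1]C[k+1]; k>n⇒nCk≡0)
  open import Data.Nat.Properties
  open import Relation.Binary.PropositionalEquality

  -- written with n = m + k so that the induction meets no truncated subtraction
  [1+k]*[m+k]C[1+k]≡m*[m+k]Ck : ∀ m k → suc k * ((m + k) C suc k) ≡ m * ((m + k) C k)
  [1+k]*[m+k]C[1+k]≡m*[m+k]Ck zero    k    = trans (cong (suc k *_) (k>n⇒nCk≡0 (n<1+n k))) (*-zeroʳ (suc k))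
  [1+k]*[m+k]C[1+k]≡m*[m+k]Ck (suc m) zero = begin
    1 * ((suc m + 0) C 1) ≡⟨ *-identityˡ _ ⟩
    (suc m + 0) C 1       ≡⟨ nC1≡n (suc m + 0) ⟩
    suc m + 0             ≡⟨ +-identityʳ (suc m) ⟩
    suc m                 ≡⟨ *-identityʳ (suc m) ⟨
    suc m * 1             ∎
    where open ≡-Reasoning
  [1+k]*[m+k]C[1+k]≡m*[m+k]Ck (suc m) (suc k) = begin
    (2 + k) * (suc n C (2 + k))  ≡⟨ cong ((2 + k) *_) (nCk+nC[k+1]≡[n+1]C[k+1] n (suc k)) ⟨
    (2 + k) * (Y + Z)            ≡⟨ *-distribˡ-+ (2 + k) Y Z ⟩
    (2 + k) * Y + (2 + k) * Z    ≡⟨ cong ((2 + k) * Y +_) ([1+k]*[m+k]C[1+k]≡m*[m+k]Ck m (suc k)) ⟩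
    (Y + (1 + k) * Y) + m * Y    ≡⟨ cong (_+ m * Y) (+-comm Y _) ⟩
    ((1 + k) * Y + Y) + m * Y    ≡⟨ +-assoc ((1 + k) * Y) Y (m * Y) ⟩
    (1 + k) * Y + (1 + m) * Y    ≡⟨ cong (_+ (1 + m) * Y) [1+k]*Y≡[1+m]*X ⟩
    (1 + m) * X + (1 + m) * Y    ≡⟨ *-distribˡ-+ (1 + m) X Y ⟨
    (1 + m) * (X + Y)            ≡⟨ cong ((1 + m) *_) (nCk+nC[k+1]≡[n+1]C[k+1] n k) ⟩
    (1 + m) * (suc n C suc k)    ∎
    where
    open ≡-Reasoning
    n X Y Z : ℕ
    n = m + suc k
    X = n C k
    Y = n C suc k
    Z = n C suc (suc k)
    [1+k]*Y≡[1+m]*X : (1 + k) * Y ≡ (1 + m) * X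
    [1+k]*Y≡[1+m]*X = subst (λ n → (1 + k) * (n C suc k) ≡ (1 + m) * (n C k)) (sym (+-suc m k))
                            ([1+k]*[m+k]C[1+k]≡m*[m+k]Ck (suc m) k)

  [1+k]*nC[1+k]≡nCk*[n∸k] : ∀ {n k} → k ≤ n → suc k * (n C suc k) ≡ (n C k) * (n ∸ k)
  [1+k]*nC[1+k]≡nCk*[n∸k] {n} {k} k≤n =
    subst (λ n → suc k * (n C suc k) ≡ (n C k) * (n ∸ k)) (m∸n+n≡m k≤n) (begin
      suc k * ((n ∸ k + k) C suc k)        ≡⟨ [1+k]*[m+k]C[1+k]≡m*[m+k]Ck (n ∸ k) k ⟩
      (n ∸ k) * ((n ∸ k + k) C k)          ≡⟨ *-comm (n ∸ k) _ ⟩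
      ((n ∸ k + k) C k) * (n ∸ k)          ≡⟨ cong (((n ∸ k + k) C k) *_) (m+n∸n≡m (n ∸ k) k) ⟨
      ((n ∸ k + k) C k) * (n ∸ k + k ∸ k)  ∎)
    where open ≡-Reasoning

module Triples where

  open import Data.Fin using (Fin)
  open import Data.Fin.Subset using (_∈_; _⊆_; ⁅_⁆; _∪_)
  open import Data.Fin.Subset.Properties
    using (x∈⁅x⁆; x∈⁅y⁆⇒x≡y; x∈p∪q⁻; x∈p∪q⁺; ∪-comm; ∪-assoc; ⊆-antisym)
  open import Data.Nat using (ℕ)
  open import Data.Product using (∃; _×_; _,_)
  open import Data.Sum as Sum using (_⊎_; inj₁; inj₂)
  open import Function using (_∘_)
  open import Relation.Binary.PropositionalEquality

  private variable
    k n : ℕ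

  module _ {a b c x : Fin n} where

    ∈-triple⁻ : x ∈ triple a b c → x ≡ a ⊎ x ≡ b ⊎ x ≡ c
    ∈-triple⁻ x∈ with x∈p∪q⁻ _ _ x∈
    ... | inj₁ x∈a = inj₁ (x∈⁅y⁆⇒x≡y a x∈a)
    ... | inj₂ x∈bc = inj₂ (Sum.map (x∈⁅y⁆⇒x≡y b) (x∈⁅y⁆⇒x≡y c) (x∈p∪q⁻ _ _ x∈bc))

    ∈-triple⁺ : x ≡ a ⊎ x ≡ b ⊎ x ≡ c → x ∈ triple a b c
    ∈-triple⁺ (inj₁ refl)        = x∈p∪q⁺ (inj₁ (x∈⁅x⁆ a))
    ∈-triple⁺ (inj₂ (inj₁ refl)) = x∈p∪q⁺ (inj₂ (x∈p∪q⁺ (inj₁ (x∈⁅x⁆ b))))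
    ∈-triple⁺ (inj₂ (inj₂ refl)) = x∈p∪q⁺ (inj₂ (x∈p∪q⁺ (inj₂ (x∈⁅x⁆ c))))

  module _ (f : Fin k → Fin n) {i j l : Fin k} where

    ∈-triple-image⁺ : ∀ {w} → w ∈ triple i j l → f w ∈ triple (f i) (f j) (f l)
    ∈-triple-image⁺ = ∈-triple⁺ ∘ Sum.map (cong f) (Sum.map (cong f) (cong f)) ∘ ∈-triple⁻

    ∈-triple-image⁻ : ∀ {z} → z ∈ triple (f i) (f j) (f l) → ∃ λ w → w ∈ triple i j l × f w ≡ z
    ∈-triple-image⁻ z∈ with ∈-triple⁻ z∈
    ... | inj₁ refl        = i , ∈-triple⁺ (inj₁ refl) , refl
    ... | inj₂ (inj₁ refl) = j , ∈-triple⁺ (inj₂ (inj₁ refl)) , refl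
    ... | inj₂ (inj₂ refl) = l , ∈-triple⁺ (inj₂ (inj₂ refl)) , refl

  triple-image-⊆ : ∀ (f : Fin k → Fin n) {i j l i′ j′ l′} → triple i j l ⊆ triple i′ j′ l′ →
                   triple (f i) (f j) (f l) ⊆ triple (f i′) (f j′) (f l′)
  triple-image-⊆ f sub z∈ with ∈-triple-image⁻ f z∈
  ... | w , w∈ , refl = ∈-triple-image⁺ f (sub w∈)

  triple-image : ∀ (f : Fin k → Fin n) {i j l i′ j′ l′} → triple i j l ≡ triple i′ j′ l′ →
                 triple (f i) (f j) (f l) ≡ triple (f i′) (f j′) (f l′)
  triple-image f eq = ⊆-antisym (triple-image-⊆ f (subst (_ ∈_) eq)) (triple-image-⊆ f (subst (_ ∈_) (sym eq)))

  triple-swap₁₂ : ∀ (a b c : Fin n) → triple a b c ≡ triple b a c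
  triple-swap₁₂ a b c = begin
    ⁅ a ⁆ ∪ (⁅ b ⁆ ∪ ⁅ c ⁆)  ≡⟨ ∪-assoc ⁅ a ⁆ ⁅ b ⁆ ⁅ c ⁆ ⟨
    (⁅ a ⁆ ∪ ⁅ b ⁆) ∪ ⁅ c ⁆  ≡⟨ cong (_∪ ⁅ c ⁆) (∪-comm ⁅ a ⁆ ⁅ b ⁆) ⟩
    (⁅ b ⁆ ∪ ⁅ a ⁆) ∪ ⁅ c ⁆  ≡⟨ ∪-assoc ⁅ b ⁆ ⁅ a ⁆ ⁅ c ⁆ ⟩
    ⁅ b ⁆ ∪ (⁅ a ⁆ ∪ ⁅ c ⁆)  ∎
    where open ≡-Reasoning

  triple-rotate : ∀ (a b c : Fin n) → triple a b c ≡ triple b c a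
  triple-rotate a b c = trans (∪-comm ⁅ a ⁆ (⁅ b ⁆ ∪ ⁅ c ⁆)) (∪-assoc ⁅ b ⁆ ⁅ c ⁆ ⁅ a ⁆)

module InducedCopies where

  open Subsets
  open import Data.Bool using (Bool; true; T; _∧_)
  import Data.Bool.Properties as Bool
  open import Data.Bool.ListAction using (all)
  open import Data.Fin using (Fin; _≟_; #_)
  open import Data.Fin.Properties using (all?)
  open import Data.Fin.Subset using (Subset; ∣_∣; _∈_; _-_)
  open import Data.Fin.Subset.Properties using (x∈p∧x≢y⇒x∈p-y)
  open import Data.List using (allFin)
  open import Data.List.Membership.Propositional.Properties using (∈-allFin)
  import Data.List.Relation.Unary.All as All
  open import Data.List.Relation.Unary.All.Properties using (all⁺)
  open import Data.List.Relation.Unary.Any using (satisfied)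
  open import Data.List.Relation.Unary.Any.Properties using (any⁻)
  open import Data.Nat using (ℕ; _≡ᵇ_)
  open import Data.Nat.Properties using (≡ᵇ⇒≡)
  open import Data.Product using (∃; _×_; _,_)
  open import Data.Sum using (inj₁; inj₂)
  open import Data.Vec using (lookup)
  open import Data.Vec.Properties using (lookup⇒[]=)
  open import Function using (_∘_; Equivalence)
  open import Function.Definitions using (Injective)
  open import Relation.Binary.PropositionalEquality
  open import Relation.Nullary using (¬_; contradiction)
  open import Relation.Nullary.Decidable using (isYes; toWitness; toWitnessFalse; ¬?; _→-dec_)

  private variable
    k n : ℕ

  IsApex : ThreeGraph k → Fin k → Set
  IsApex H i = ∀ j l → j ≢ i → l ≢ i → j ≢ l → edge H (triple i j l) ≡ true

  record Apex (G : ThreeGraph n) (X : Subset n) : Set where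
    field
      apex          : Fin n
      apex∈X        : apex ∈ X
      link-complete : ∀ {a b} → a ∈ X - apex → b ∈ X - apex → a ≢ b → edge G (triple apex a b) ≡ true

  record InducedCopy (H : ThreeGraph k) (G : ThreeGraph n) (X : Subset n) : Set where
    field
      vertex    : Fin k → Fin n
      vertex∈X  : ∀ i → vertex i ∈ X
      injective : Injective _≡_ _≡_ vertex
      edge-≡    : ∀ i j l → edge H (triple i j l) ≡ edge G (triple (vertex i) (vertex j) (vertex l))

    onto : ∣ X ∣ ≡ k → ∀ {x} → x ∈ X → ∃ λ i → vertex i ≡ x
    onto = injection⇒surjective vertex injective vertex∈X

    image-of-apex : ∣ X ∣ ≡ k → ∀ {i} → IsApex H i → Apex G X
    image-of-apex ∣X∣≡k {i} i-apex =
      record { apex = vertex i ; apex∈X = vertex∈X i ; link-complete = link }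
      where
      link : ∀ {a b} → a ∈ X - vertex i → b ∈ X - vertex i → a ≢ b → edge G (triple (vertex i) a b) ≡ true
      link a∈ b∈ a≢b with onto ∣X∣≡k (x∈p-y⇒x∈p a∈) | onto ∣X∣≡k (x∈p-y⇒x∈p b∈)
      ... | j , refl | l , refl = trans (sym (edge-≡ i j l)) (i-apex j l
        (x∈p-y⇒x≢y a∈ ∘ cong vertex) (x∈p-y⇒x≢y b∈ ∘ cong vertex) (a≢b ∘ cong vertex))

  T-all-allFin : ∀ {p : Fin k → Bool} → T (all p (allFin k)) → ∀ i → T (p i)
  T-all-allFin {p = p} all-p i = All.lookup (all⁺ p _ all-p) (∈-allFin i)

  inducedIso?⇒InducedCopy : ∀ {H : ThreeGraph k} {G : ThreeGraph n} {X} →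
                            T (inducedIso? H G X) → InducedCopy H G X
  inducedIso?⇒InducedCopy {k} {n} {H} {G} {X} iso with satisfied (any⁻ _ (allMaps k n) iso)
  ... | v , good-v with Equivalence.to Bool.T-∧ good-v
  ... | in-X , rest with Equivalence.to Bool.T-∧ rest
  ... | distinct , edges = record
    { vertex    = lookup v
    ; vertex∈X  = λ i → lookup⇒[]= _ X (Equivalence.to Bool.T-≡ (T-all-allFin in-X i))
    ; injective = λ {i} {j} → injective i j
    ; edge-≡    = λ i j l → toWitness (T-all-allFin (T-all-allFin (T-all-allFin edges i) j) l)
    }
    where
    injective : ∀ i j → lookup v i ≡ lookup v j → i ≡ j
    injective i j vi≡vj
      with Equivalence.to (Bool.T-∨ {isYes (i ≟ j)}) (T-all-allFin (T-all-allFin distinct i) j)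
    ... | inj₁ i≡j   = toWitness {a? = i ≟ j} i≡j
    ... | inj₂ vi≢vj = contradiction vi≡vj (toWitnessFalse {a? = lookup v i ≟ lookup v j} vi≢vj)

  -- inducedCount H G is countᵇ (inducedCopy? H G) (allSubsets n) by definition
  inducedCopy? : ThreeGraph k → ThreeGraph n → Subset n → Bool
  inducedCopy? {k = k} H G X = (∣ X ∣ ≡ᵇ k) ∧ inducedIso? H G X

  inducedCopy?⇒InducedCopy : ∀ (H : ThreeGraph k) (G : ThreeGraph n) {X} →
                             T (inducedCopy? H G X) → ∣ X ∣ ≡ k × InducedCopy H G X
  inducedCopy?⇒InducedCopy {k = k} H G {X} copy with Equivalence.to Bool.T-∧ copy
  ... | size , iso = ≡ᵇ⇒≡ ∣ X ∣ k size , inducedIso?⇒InducedCopy iso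

  K4-apex : ∀ i → IsApex K4 i
  K4-apex = toWitness {a? = all? λ i → all? λ j → all? λ l →
    ¬? (j ≟ i) →-dec ¬? (l ≟ i) →-dec ¬? (j ≟ l) →-dec edge K4 (triple i j l) Bool.≟ true} _

  K4⁻-apex : IsApex K4⁻ (# 3)
  K4⁻-apex = toWitness {a? = all? λ j → all? λ l →
    ¬? (j ≟ # 3) →-dec ¬? (l ≟ # 3) →-dec ¬? (j ≟ l) →-dec edge K4⁻ (triple (# 3) j l) Bool.≟ true} _

  -- Under a K4 copy every vertex of X is an apex, so the non-edge v0 v1 v2 of the K4⁻ copy would be an edge.
  K4⁻-copy⇒¬K4-copy : ∀ {G : ThreeGraph n} {X} → ∣ X ∣ ≡ 4 → InducedCopy K4⁻ G X → ¬ InducedCopy K4 G X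
  K4⁻-copy⇒¬K4-copy {G = G} {X} ∣X∣≡4 I⁻ I
    with InducedCopy.onto I ∣X∣≡4 (InducedCopy.vertex∈X I⁻ (# 0))
  ... | k , wk≡v0 = contradiction (trans (I⁻.edge-≡ (# 0) (# 1) (# 2)) v0v1v2) λ ()
    where
    module I⁻ = InducedCopy I⁻
    module I = InducedCopy I
    open Apex (I.image-of-apex ∣X∣≡4 (K4-apex k))
    ∈X-apex : ∀ i → i ≢ # 0 → I⁻.vertex i ∈ X - apex
    ∈X-apex i i≢0 = x∈p∧x≢y⇒x∈p-y (I⁻.vertex∈X i) (i≢0 ∘ I⁻.injective ∘ λ eq → trans eq wk≡v0)
    v0v1v2 : edge G (triple (I⁻.vertex (# 0)) (I⁻.vertex (# 1)) (I⁻.vertex (# 2))) ≡ true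
    v0v1v2 = subst (λ x → edge G (triple x _ _) ≡ true) wk≡v0
      (link-complete (∈X-apex (# 1) λ ()) (∈X-apex (# 2) λ ()) (λ eq → contradiction (I⁻.injective eq) λ ()))

module ApexRemoval where

  open Counting
  open Subsets
  open Binomial
  open Triples
  open InducedCopies
  open import Data.Bool using (Bool; true; T; _∨_)
  import Data.Bool.Properties as Bool
  open import Data.Fin using (Fin; _≟_; #_)
  open import Data.Fin.Subset using (Subset; ∣_∣; _∈_; _-_)
  open import Data.List.Relation.Unary.Any as Any using (Any; here; there)
  open import Data.List.Relation.Unary.Any.Properties using (any⁻)
  open import Data.Nat using (ℕ; _≡ᵇ_; _+_; _*_; _∸_; _≤_)
  open import Data.Nat.Combinatorics using (_C_)
  open import Data.Nat.Properties using (suc-injective; ≡⇒≡ᵇ; *-monoˡ-≤; ≤-trans; n≤1+n; module ≤-Reasoning)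
  open import Data.Product using (Σ; _×_; _,_; proj₁; proj₂)
  open import Data.Sum using (inj₁; inj₂)
  open import Data.Vec using ([]; _∷_; lookup)
  import Data.Vec.Properties as Vec
  open import Data.Vec.Relation.Unary.All using ([]; _∷_)
  open import Data.Vec.Relation.Unary.Unique.Propositional using (Unique; []; _∷_)
  open import Data.Vec.Relation.Unary.Unique.Propositional.Properties using (lookup-injective)
  open import Function using (Equivalence)
  open import Function.Definitions using (Injective)
  open import Relation.Binary.PropositionalEquality
  open import Relation.Nullary using (¬_; yes; no; contradiction)
  open import Relation.Nullary.Decidable using (toWitness)

  private variable
    n : ℕ

  C5⁻-edge : ∀ {S} → edge C5⁻ S ≡ true → Any (S ≡_) C5⁻edges
  C5⁻-edge {S} e = Any.map (λ {T} → toWitness {a? = Vec.≡-dec Bool._≟_ S T})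
    (any⁻ _ C5⁻edges (proj₂ (Equivalence.to Bool.T-∧ (Equivalence.from Bool.T-≡ e))))

  C5⁻-copy : ∀ (G : ThreeGraph n) (a b c d e : Fin n) → Unique (a ∷ b ∷ c ∷ d ∷ e ∷ []) →
    edge G (triple a b c) ≡ true → edge G (triple b c d) ≡ true →
    edge G (triple c d e) ≡ true → edge G (triple d e a) ≡ true → Contains G C5⁻
  C5⁻-copy {n} G a b c d e distinct abc bcd cde dea = f , (λ {i} {j} → lookup-injective distinct i j) , preserves
    where
    f : Fin 5 → Fin n
    f = lookup (a ∷ b ∷ c ∷ d ∷ e ∷ [])
    image-edge : ∀ {i j l} i′ j′ l′ → triple i j l ≡ triple i′ j′ l′ →
                 edge G (triple (f i′) (f j′) (f l′)) ≡ true → edge G (triple (f i) (f j) (f l)) ≡ true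
    image-edge i′ j′ l′ eq = subst (λ S → edge G S ≡ true) (sym (triple-image f {i′ = i′} {j′} {l′} eq))
    preserves : ∀ i j l → edge C5⁻ (triple i j l) ≡ true → edge G (triple (f i) (f j) (f l)) ≡ true
    preserves i j l e with C5⁻-edge {S = triple i j l} e
    ... | here eq                         = image-edge (# 0) (# 1) (# 2) eq abc
    ... | there (here eq)                 = image-edge (# 1) (# 2) (# 3) eq bcd
    ... | there (there (here eq))         = image-edge (# 2) (# 3) (# 4) eq cde
    ... | there (there (there (here eq))) = image-edge (# 3) (# 4) (# 0) eq dea

  apex-removal-injective : ∀ {G : ThreeGraph n} {X Y} → Free C5⁻ G → ∣ X ∣ ≡ 4 →
    (A : Apex G X) (B : Apex G Y) → X - Apex.apex A ≡ Y - Apex.apex B → X ≡ Y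
  apex-removal-injective {n} {G} {X} {Y} free ∣X∣≡4 A B X-x≡Y-y with Apex.apex A ≟ Apex.apex B
  ... | yes refl = p-x≡q-x⇒p≡q (Apex.apex∈X A) (Apex.apex∈X B) X-x≡Y-y
  ... | no x≢y = contradiction (C5⁻-copy G a x b c y distinct axb xbc bcy cya) free
    where
    open Apex A renaming (apex to x; link-complete to x-link)
    open Apex B using () renaming (apex to y; link-complete to y-link)
    enumeration : Σ (Fin 3 → Fin n) λ f → Injective _≡_ _≡_ f × (∀ i → f i ∈ X - x)
    enumeration = enumerate (suc-injective (trans (x∈p⇒suc∣p-x∣≡∣p∣ apex∈X) ∣X∣≡4))
    f : Fin 3 → Fin n
    f = proj₁ enumeration
    f-injective : Injective _≡_ _≡_ f
    f-injective = proj₁ (proj₂ enumeration)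
    f∈X-x : ∀ i → f i ∈ X - x
    f∈X-x = proj₂ (proj₂ enumeration)
    a b c : Fin n
    a = f (# 0)
    b = f (# 1)
    c = f (# 2)
    f∈Y-y : ∀ i → f i ∈ Y - y
    f∈Y-y i = subst (f i ∈_) X-x≡Y-y (f∈X-x i)
    a≢b : a ≢ b
    a≢b eq with () ← f-injective {# 0} {# 1} eq
    a≢c : a ≢ c
    a≢c eq with () ← f-injective {# 0} {# 2} eq
    b≢c : b ≢ c
    b≢c eq with () ← f-injective {# 1} {# 2} eq
    x≢f : ∀ i → x ≢ f i
    x≢f i = ≢-sym (x∈p-y⇒x≢y (f∈X-x i))
    y≢f : ∀ i → y ≢ f i
    y≢f i = ≢-sym (x∈p-y⇒x≢y (f∈Y-y i))
    distinct : Unique (a ∷ x ∷ b ∷ c ∷ y ∷ [])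
    distinct = (≢-sym (x≢f (# 0)) ∷ a≢b ∷ a≢c ∷ ≢-sym (y≢f (# 0)) ∷ [])
             ∷ (x≢f (# 1) ∷ x≢f (# 2) ∷ x≢y ∷ [])
             ∷ (b≢c ∷ ≢-sym (y≢f (# 1)) ∷ [])
             ∷ (≢-sym (y≢f (# 2)) ∷ [])
             ∷ [] ∷ []
    axb : edge G (triple a x b) ≡ true
    axb = subst (λ S → edge G S ≡ true) (triple-swap₁₂ x a b)
                (x-link (f∈X-x (# 0)) (f∈X-x (# 1)) a≢b)
    xbc : edge G (triple x b c) ≡ true
    xbc = x-link (f∈X-x (# 1)) (f∈X-x (# 2)) b≢c
    bcy : edge G (triple b c y) ≡ true
    bcy = subst (λ S → edge G S ≡ true) (triple-rotate y b c)
                (y-link (f∈Y-y (# 1)) (f∈Y-y (# 2)) b≢c)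
    cya : edge G (triple c y a) ≡ true
    cya = subst (λ S → edge G S ≡ true) (triple-swap₁₂ y c a)
                (y-link (f∈Y-y (# 2)) (f∈Y-y (# 0)) (≢-sym a≢c))

  module _ {G : ThreeGraph n} where

    K4⁻-or-K4? : Subset n → Bool
    K4⁻-or-K4? X = inducedCopy? K4⁻ G X ∨ inducedCopy? K4 G X

    K4⁻-or-K4-apex : ∀ X → T (K4⁻-or-K4? X) → ∣ X ∣ ≡ 4 × Apex G X
    K4⁻-or-K4-apex X copy with Equivalence.to (Bool.T-∨ {inducedCopy? K4⁻ G X}) copy
    ... | inj₁ copy⁻ = let ∣X∣≡4 , I = inducedCopy?⇒InducedCopy K4⁻ G {X} copy⁻ in
                       ∣X∣≡4 , InducedCopy.image-of-apex I ∣X∣≡4 K4⁻-apex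
    ... | inj₂ copy  = let ∣X∣≡4 , I = inducedCopy?⇒InducedCopy K4 G {X} copy in
                       ∣X∣≡4 , InducedCopy.image-of-apex I ∣X∣≡4 (K4-apex (# 3))

    inducedCount-K4⁻+K4≤nC3 : Free C5⁻ G → inducedCount K4⁻ G + inducedCount K4 G ≤ n C 3
    inducedCount-K4⁻+K4≤nC3 free = begin
      inducedCount K4⁻ G + inducedCount K4 G
        ≡⟨ countᵇ-∨ (inducedCopy? K4⁻ G) (inducedCopy? K4 G) (allSubsets n) disjoint ⟩
      countᵇ K4⁻-or-K4? (allSubsets n)
        ≤⟨ countᵇ-≤-injection (allSubsets-unique n) allSubsets-complete
                              remove-apex remove-apex-size remove-apex-injective ⟩
      countᵇ (λ S → ∣ S ∣ ≡ᵇ 3) (allSubsets n)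
        ≡⟨ countᵇ-size≡C n 3 ⟩
      n C 3
        ∎
      where
      open ≤-Reasoning
      disjoint : ∀ X → T (inducedCopy? K4⁻ G X) → ¬ T (inducedCopy? K4 G X)
      disjoint X copy⁻ copy = let ∣X∣≡4 , I⁻ = inducedCopy?⇒InducedCopy K4⁻ G {X} copy⁻ in
        K4⁻-copy⇒¬K4-copy ∣X∣≡4 I⁻ (proj₂ (inducedCopy?⇒InducedCopy K4 G {X} copy))
      remove-apex : ∀ X → T (K4⁻-or-K4? X) → Subset n
      remove-apex X copy = X - Apex.apex (proj₂ (K4⁻-or-K4-apex X copy))
      remove-apex-size : ∀ X copy → T (∣ remove-apex X copy ∣ ≡ᵇ 3)
      remove-apex-size X copy = let ∣X∣≡4 , A = K4⁻-or-K4-apex X copy in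
        ≡⇒≡ᵇ _ 3 (suc-injective (trans (x∈p⇒suc∣p-x∣≡∣p∣ (Apex.apex∈X A)) ∣X∣≡4))
      remove-apex-injective : ∀ X Y copyX copyY → remove-apex X copyX ≡ remove-apex Y copyY → X ≡ Y
      remove-apex-injective X Y copyX copyY = let ∣X∣≡4 , A = K4⁻-or-K4-apex X copyX in
        apex-removal-injective free ∣X∣≡4 A (proj₂ (K4⁻-or-K4-apex Y copyY))

    [inducedCount-K4⁻+K4]*[n∸3]≤4*nC4 : 4 ≤ n → Free C5⁻ G →
      (inducedCount K4⁻ G + inducedCount K4 G) * (n ∸ 3) ≤ 4 * (n C 4)
    [inducedCount-K4⁻+K4]*[n∸3]≤4*nC4 n≥4 free = begin
      (inducedCount K4⁻ G + inducedCount K4 G) * (n ∸ 3)  ≤⟨ *-monoˡ-≤ (n ∸ 3) (inducedCount-K4⁻+K4≤nC3 free) ⟩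
      (n C 3) * (n ∸ 3)                                   ≡⟨ [1+k]*nC[1+k]≡nCk*[n∸k] (≤-trans (n≤1+n 3) n≥4) ⟨
      4 * (n C 4)                                         ∎
      where open ≤-Reasoning

module Rationals where

  open import Data.Nat using (suc; _+_; _*_; _≤_; NonZero)
  open import Data.Nat.Properties using (*-distribʳ-+; *-assoc; *-comm; *-monoˡ-≤; module ≤-Reasoning)
  open import Data.Integer as ℤ using (+_; +≤+)
  import Data.Integer.Properties as ℤ
  open import Data.Rational as ℚ using (_/_; toℚᵘ)
  open import Data.Rational.Properties using (toℚᵘ-cancel-≤; toℚᵘ-homo-+; toℚᵘ-fromℚᵘ)
  open import Data.Rational.Unnormalised as ℚᵘ using (*≤*)
  import Data.Rational.Unnormalised.Properties as ℚᵘ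
  open import Relation.Binary.PropositionalEquality

  -- fromℚᵘ (+ a ℚᵘ./ n) is + a / n by definition
  toℚᵘ-/ : ∀ a n .{{_ : NonZero n}} → toℚᵘ (+ a / n) ℚᵘ.≃ (+ a ℚᵘ./ n)
  toℚᵘ-/ a (suc n) = toℚᵘ-fromℚᵘ (+ a ℚᵘ./ suc n)

  a/n+b/n≤c/m : ∀ a b c n m .{{_ : NonZero n}} .{{_ : NonZero m}} →
                (a + b) * m ≤ c * n → + a / n ℚ.+ + b / n ℚ.≤ + c / m
  a/n+b/n≤c/m a b c n@(suc _) m@(suc _) [a+b]m≤cn =
    toℚᵘ-cancel-≤ (ℚᵘ.≤-respˡ-≃ (ℚᵘ.≃-sym toℚᵘ-lhs)
                  (ℚᵘ.≤-respʳ-≃ (ℚᵘ.≃-sym (toℚᵘ-/ c m)) (*≤* cross-multiplied)))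
    where
    toℚᵘ-lhs : toℚᵘ (+ a / n ℚ.+ + b / n) ℚᵘ.≃ (+ a ℚᵘ./ n) ℚᵘ.+ (+ b ℚᵘ./ n)
    toℚᵘ-lhs = ℚᵘ.≃-trans (toℚᵘ-homo-+ (+ a / n) (+ b / n)) (ℚᵘ.+-cong (toℚᵘ-/ a n) (toℚᵘ-/ b n))
    cast : + ((a * n + b * n) * m) ≡ (+ a ℤ.* + n ℤ.+ + b ℤ.* + n) ℤ.* + m
    cast = trans (ℤ.pos-* (a * n + b * n) m)
                 (cong (ℤ._* + m) (trans (ℤ.pos-+ (a * n) (b * n)) (cong₂ ℤ._+_ (ℤ.pos-* a n) (ℤ.pos-* b n))))
    cross-multiplied : (+ a ℤ.* + n ℤ.+ + b ℤ.* + n) ℤ.* + m ℤ.≤ + c ℤ.* + (n * n)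
    cross-multiplied = subst₂ ℤ._≤_ cast (ℤ.pos-* c (n * n)) (+≤+ (begin
      (a * n + b * n) * m  ≡⟨ cong (_* m) (*-distribʳ-+ n a b) ⟨
      (a + b) * n * m      ≡⟨ *-assoc (a + b) n m ⟩
      (a + b) * (n * m)    ≡⟨ cong ((a + b) *_) (*-comm n m) ⟩
      (a + b) * (m * n)    ≡⟨ *-assoc (a + b) m n ⟨
      (a + b) * m * n      ≤⟨ *-monoˡ-≤ n [a+b]m≤cn ⟩
      c * n * n            ≡⟨ *-assoc c n n ⟩
      c * (n * n)          ∎))
      where open ≤-Reasoning

open import Data.Nat using (ℕ; _∸_; >-nonZero)
open import Data.Nat.Combinatorics using (_C_)
open import Data.Integer using (+_)
open import Data.Rational using (_+_; _≤_; _/_)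
open ApexRemoval using ([inducedCount-K4⁻+K4]*[n∸3]≤4*nC4)
open Rationals using (a/n+b/n≤c/m)

proposition1 : ∀ {n : ℕ} (G : ThreeGraph n) (n≥4 : 4 Data.Nat.≤ n) →
    Free C5⁻ G →
    p K4⁻ G n≥4 + p K4 G n≥4 ≤ (+ 4 / (n ∸ 3)) {{n∸3-nonZero n≥4}}
proposition1 {n} G n≥4 free =
  a/n+b/n≤c/m (inducedCount K4⁻ G) (inducedCount K4 G) 4 (n C 4) (n ∸ 3)
    {{>-nonZero (nCk>0 n≥4)}} {{n∸3-nonZero n≥4}}
    ([inducedCount-K4⁻+K4]*[n∸3]≤4*nC4 {G = G} n≥4 free)
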